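{- Let $n\geq 2$. For every tree $T$ on $n$ vertices, $\sigma_{t}(T)\geq 2n-4$, with equality if and only if $T$ is the path $P_n$.
   Context: For a finite simple graph $G$ with $d(v)$ the degree of $v$, $\sigma_{t}(G)=\sum_{\{u,v\}\subseteq V(G)}(d(u)-d(v))^{2}$, summing over all unordered pairs of distinct vertices. -}

module Defs where

open import Data.Nat using (ℕ; zero; suc; _+_; _*_; _<ᵇ_; ∣_-_∣; _≡ᵇ_)
open import Data.Bool using (Bool; true; false; if_then_else_)
open import Data.Fin using (Fin; toℕ; inject₁; fromℕ)
import Data.Fin as F
open import Data.Product using (Σ; ∃; _×_)
open import Relation.Binary.PropositionalEquality using (_≡_)
open import Relation.Nullary using (¬_)
open import Function.Definitions using (Injective)
open import Function.Bundles using (_↔_; Inverse)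

record Graph (n : ℕ) : Set where
  field
    adj     : Fin n → Fin n → Bool
    symm    : ∀ u v → adj u v ≡ adj v u
    irrefl  : ∀ v → adj v v ≡ false
open Graph public

sumFin : {n : ℕ} → (Fin n → ℕ) → ℕ
sumFin {zero}  f = 0
sumFin {suc n} f = f F.zero + sumFin (λ i → f (F.suc i))

bool→ℕ : Bool → ℕ
bool→ℕ true  = 1
bool→ℕ false = 0

degree : {n : ℕ} → Graph n → Fin n → ℕ
degree G v = sumFin (λ u → bool→ℕ (adj G v u))

sigmaT : {n : ℕ} → Graph n → ℕ
sigmaT G = sumFin (λ u → sumFin (λ v →
  if toℕ u <ᵇ toℕ v
  then ∣ degree G u - degree G v ∣ * ∣ degree G u - degree G v ∣
  else 0))

data Walk {n : ℕ} (G : Graph n) : Fin n → Fin n → Set where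
  here : ∀ {v} → Walk G v v
  step : ∀ {u w v} → adj G u w ≡ true → Walk G w v → Walk G u v

Connected : {n : ℕ} → Graph n → Set
Connected G = ∀ u v → Walk G u v

-- A cycle of length m+3: injective sequence c₀,…,c_{m+2} of vertices with
-- consecutive vertices adjacent and c_{m+2} adjacent to c₀.
record Cycle {n : ℕ} (G : Graph n) : Set where
  field
    m      : ℕ
    c      : Fin (suc (suc (suc m))) → Fin n
    inj    : Injective _≡_ _≡_ c
    consec : ∀ (i : Fin (suc (suc m))) → adj G (c (inject₁ i)) (c (F.suc i)) ≡ true
    close  : adj G (c (fromℕ (suc (suc m)))) (c F.zero) ≡ true

Acyclic : {n : ℕ} → Graph n → Set
Acyclic G = ¬ Cycle G

IsTree : {n : ℕ} → Graph n → Set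
IsTree G = Connected G × Acyclic G

pathGraph : (n : ℕ) → Graph n
pathGraph n = record
  { adj    = λ i j → ∣ toℕ i - toℕ j ∣ ≡ᵇ 1
  ; symm   = λ i j → symLemma (toℕ i) (toℕ j)
  ; irrefl = λ v → irrLemma (toℕ v)
  }
  where
  open import Data.Nat.Properties using (∣-∣-comm; ∣n-n∣≡0)
  open import Relation.Binary.PropositionalEquality using (cong; trans)
  symLemma : ∀ a b → (∣ a - b ∣ ≡ᵇ 1) ≡ (∣ b - a ∣ ≡ᵇ 1)
  symLemma a b = cong (_≡ᵇ 1) (∣-∣-comm a b)
  irrLemma : ∀ a → (∣ a - a ∣ ≡ᵇ 1) ≡ false
  irrLemma a = cong (_≡ᵇ 1) (∣n-n∣≡0 a)

Isomorphic : {n : ℕ} → Graph n → Graph n → Set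
Isomorphic {n} G H = Σ (Fin n ↔ Fin n) λ φ →
  ∀ u v → adj G u v ≡ adj H (Inverse.to φ u) (Inverse.to φ v)

{-# OPTIONS --safe #-}
-- Let a and b be the two ends of a maximal path in the tree T.  Both are
-- leaves, so the pairs {a, u} and {b, u} alone contribute 2 Σᵤ (d u - 1)² to
-- σₜ(T).  Since (d - 1)² ≥ d - 1, with equality iff d ≤ 2, and the degrees of a
-- connected graph on n vertices sum to at least 2 (n - 1) (count the edges of a
-- breadth-first spanning tree), σₜ(T) ≥ 2 (n - 2), strictly so if some degree
-- is at least 3.  When all degrees are at most 2 the maximal path passes through
-- every vertex, so T is the path P_n; conversely P_n has degree sequence
-- 1, 2, …, 2, 1, for which all pairs not meeting {a, b} contribute 0.
module Submission where

open import Defs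
open import Data.Nat using (ℕ; _≤_; _+_; _*_; _∸_)
open import Data.Product using (_×_)
open import Relation.Binary.PropositionalEquality using (_≡_)
open import Function.Bundles using (_⇔_)

open import Data.Nat using (zero; suc; _<_; z≤n; s≤s; ∣_-_∣; _<ᵇ_; _≡ᵇ_)
open import Data.Nat.Properties hiding (_≟_)
open import Data.Bool using (Bool; true; false; T; T?; if_then_else_)
import Data.Bool as Bool
open import Data.Bool.Properties using (⇔→≡)
open import Data.Empty using (⊥)
open import Data.Fin using (Fin; zero; suc; toℕ; fromℕ; fromℕ<; inject₁; punchOut)
open import Data.Fin.Properties
  using ( _≟_; any?; injective⇒≤; toℕ-injective; toℕ<n; toℕ≤pred[n]; toℕ-inject₁; toℕ-fromℕ
        ; toℕ-fromℕ<; fromℕ<-injective; punchIn-punchOut; punchOut-injective; punchInᵢ≢i )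
open import Data.Product using (Σ; ∃; _,_; proj₁; proj₂)
open import Data.Sum using (_⊎_; inj₁; inj₂; [_,_]′)
import Data.Sum as Sum
open import Data.Vec.Functional using (removeAt)
open import Function using (_∘_)
open import Function.Bundles using (Inverse; mk⇔; mk↔ₛ′)
open import Relation.Binary.Definitions using (tri<; tri≈; tri>)
open import Relation.Binary.PropositionalEquality
  using (_≢_; refl; sym; trans; cong; cong₂; subst; module ≡-Reasoning)
open import Relation.Nullary using (¬_; Dec; yes; no; does; contradiction; _⊎-dec_; _×-dec_)
open import Relation.Nullary.Decidable using (dec-true; dec-false; map′; decidable-stable; ¬?)
open import Relation.Nullary.Reflects using (ofʸ; ofⁿ)
open import Relation.Unary using (Decidable)
open import Algebra.Properties.Semiring.Sum +-*-semiring
  using (sum; sum-cong-≗; ∑-distrib-+; ∑-comm; sum-remove; sum-permute; *-distribˡ-sum; *-distribʳ-sum)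

-- Finite sums

sumFin≡sum : ∀ {n} (f : Fin n → ℕ) → sumFin f ≡ sum f
sumFin≡sum {zero}  f = refl
sumFin≡sum {suc n} f = cong (f zero +_) (sumFin≡sum (f ∘ suc))

sumFin²≡sum² : ∀ {m n} (g : Fin m → Fin n → ℕ) → sumFin (λ u → sumFin (g u)) ≡ sum (λ u → sum (g u))
sumFin²≡sum² g = trans (sumFin≡sum (λ u → sumFin (g u))) (sum-cong-≗ (λ u → sumFin≡sum (g u)))

sum-mono-≤ : ∀ {n} {f g : Fin n → ℕ} → (∀ i → f i ≤ g i) → sum f ≤ sum g
sum-mono-≤ {zero}  f≤g = z≤n
sum-mono-≤ {suc n} f≤g = +-mono-≤ (f≤g zero) (sum-mono-≤ (f≤g ∘ suc))

sum-mono-< : ∀ {n} {f g : Fin n → ℕ} → (∀ i → f i ≤ g i) → ∀ i → f i < g i → sum f < sum g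
sum-mono-< f≤g zero    fi<gi = +-mono-<-≤ fi<gi (sum-mono-≤ (f≤g ∘ suc))
sum-mono-< f≤g (suc i) fi<gi = +-mono-≤-< (f≤g zero) (sum-mono-< (f≤g ∘ suc) i fi<gi)

sum-const : ∀ n c → sum {n} (λ _ → c) ≡ n * c
sum-const zero    c = refl
sum-const (suc n) c = cong (c +_) (sum-const n c)

sum-one : ∀ n → sum {n} (λ _ → 1) ≡ n
sum-one n = trans (sum-const n 1) (*-identityʳ n)

sum-zero : ∀ {n} {f : Fin n → ℕ} → (∀ i → f i ≡ 0) → sum f ≡ 0
sum-zero {n} f≡0 = trans (sum-cong-≗ f≡0) (trans (sum-const n 0) (*-zeroʳ n))

sum-single : ∀ {n} (f : Fin n → ℕ) i → (∀ j → j ≢ i → f j ≡ 0) → sum f ≡ f i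
sum-single {suc n} f i f≡0 = begin
  sum f                     ≡⟨ sum-remove f ⟩
  f i + sum (removeAt f i)  ≡⟨ cong (f i +_) (sum-zero (λ j → f≡0 _ (punchInᵢ≢i i j))) ⟩
  f i + 0                   ≡⟨ +-identityʳ (f i) ⟩
  f i                       ∎
  where open ≡-Reasoning

≤-sum : ∀ {n} (f : Fin n → ℕ) i → f i ≤ sum f
≤-sum {suc n} f i = ≤-trans (m≤m+n (f i) _) (≤-reflexive (sym (sum-remove f)))

removeAt-punchOut : ∀ {n} (f : Fin (suc n) → ℕ) {i j} (i≢j : i ≢ j) → removeAt f i (punchOut i≢j) ≡ f j
removeAt-punchOut f i≢j = cong f (punchIn-punchOut i≢j)

pair-≤-sum : ∀ {n} (f : Fin n → ℕ) {i j} → i ≢ j → f i + f j ≤ sum f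
pair-≤-sum {suc n} f {i} {j} i≢j = begin
  f i + f j                ≡⟨ cong (f i +_) (removeAt-punchOut f i≢j) ⟨
  f i + removeAt f i _     ≤⟨ +-monoʳ-≤ (f i) (≤-sum (removeAt f i) _) ⟩
  f i + sum (removeAt f i) ≡⟨ sum-remove f ⟨
  sum f                    ∎
  where open ≤-Reasoning

triple-≤-sum : ∀ {n} (f : Fin n → ℕ) {i j k} → i ≢ j → i ≢ k → j ≢ k → f i + f j + f k ≤ sum f
triple-≤-sum {suc n} f {i} {j} {k} i≢j i≢k j≢k = begin
  f i + f j + f k                          ≡⟨ +-assoc (f i) (f j) (f k) ⟩
  f i + (f j + f k)                        ≡⟨ cong (f i +_) (cong₂ _+_ (removeAt-punchOut f i≢j)
                                                                    (removeAt-punchOut f i≢k)) ⟨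
  f i + (removeAt f i _ + removeAt f i _)  ≤⟨ +-monoʳ-≤ (f i) (pair-≤-sum (removeAt f i)
                                                (j≢k ∘ punchOut-injective i≢j i≢k)) ⟩
  f i + sum (removeAt f i)                 ≡⟨ sum-remove f ⟨
  sum f                                    ∎
  where open ≤-Reasoning

δ : ∀ {n} → Fin n → Fin n → ℕ
δ i j = bool→ℕ (does (i ≟ j))

sum-δ : ∀ {n} (i : Fin n) → sum (δ i) ≡ 1
sum-δ i = trans (sum-single (δ i) i (λ j j≢i → cong bool→ℕ (dec-false (i ≟ j) (j≢i ∘ sym))))
                (cong bool→ℕ (dec-true (i ≟ i) refl))

bool→ℕ≤1 : ∀ b → bool→ℕ b ≤ 1
bool→ℕ≤1 true  = ≤-refl
bool→ℕ≤1 false = z≤n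

bool→ℕ-¬T : ∀ {b} → ¬ T b → bool→ℕ b ≡ 0
bool→ℕ-¬T {true}  ¬t = contradiction _ ¬t
bool→ℕ-¬T {false} _  = refl

sum-≤-1 : ∀ {n} (p : Fin n → Bool) → (∀ {i j} → T (p i) → T (p j) → i ≡ j) →
          sum (bool→ℕ ∘ p) ≤ 1
sum-≤-1 p unique with any? (T? ∘ p)
... | yes (i , pᵢ) =
  ≤-trans (≤-reflexive (sum-single _ i λ j j≢i → bool→ℕ-¬T (j≢i ∘ λ pⱼ → unique pⱼ pᵢ))) (bool→ℕ≤1 (p i))
... | no none      = ≤-trans (≤-reflexive (sum-zero λ j → bool→ℕ-¬T (none ∘ (j ,_)))) z≤n

-- The degree-sequence inequality

∣_-_∣² : ℕ → ℕ → ℕ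
∣ x - y ∣² = ∣ x - y ∣ * ∣ x - y ∣

-- sigmaT G unfolds to σₜ (degree G).
σₜ : ∀ {n} → (Fin n → ℕ) → ℕ
σₜ f = sumFin (λ u → sumFin (λ v → if toℕ u <ᵇ toℕ v then ∣ f u - f v ∣² else 0))

upperTriangle : ∀ {n} → (Fin n → Fin n → ℕ) → Fin n → Fin n → ℕ
upperTriangle g u v = if toℕ u <ᵇ toℕ v then g u v else 0

module _ {n} {g : Fin n → Fin n → ℕ} (g-sym : ∀ u v → g u v ≡ g v u) (g-diag : ∀ u → g u u ≡ 0) where

  upperTriangle-split : ∀ u v → upperTriangle g u v + upperTriangle g v u ≡ g u v
  upperTriangle-split u v
    with toℕ u <ᵇ toℕ v | <ᵇ-reflects-< (toℕ u) (toℕ v)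
       | toℕ v <ᵇ toℕ u | <ᵇ-reflects-< (toℕ v) (toℕ u)
  ... | true  | ofʸ u<v | true  | ofʸ v<u = contradiction v<u (<-asym u<v)
  ... | true  | _       | false | _       = +-identityʳ (g u v)
  ... | false | _       | true  | _       = g-sym v u
  ... | false | ofⁿ u≮v | false | ofⁿ v≮u =
    sym (subst (λ w → g u w ≡ 0) (toℕ-injective (≤-antisym (≮⇒≥ v≮u) (≮⇒≥ u≮v))) (g-diag u))

  2*sum-upperTriangle : 2 * sum (λ u → sum (upperTriangle g u)) ≡ sum (λ u → sum (g u))
  2*sum-upperTriangle = begin
    2 * U                                      ≡⟨ cong (U +_) (+-identityʳ U) ⟩
    U + U                                      ≡⟨ cong (U +_) (∑-comm L) ⟩
    U + sum (λ u → sum (λ v → L v u))          ≡⟨ ∑-distrib-+ (λ u → sum (L u)) _ ⟨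
    sum (λ u → sum (L u) + sum (λ v → L v u))  ≡⟨ sum-cong-≗ (λ u → ∑-distrib-+ (L u) _) ⟨
    sum (λ u → sum (λ v → L u v + L v u))      ≡⟨ sum-cong-≗ (λ u → sum-cong-≗ (upperTriangle-split u)) ⟩
    sum (λ u → sum (g u))                      ∎
    where
    open ≡-Reasoning
    L = upperTriangle g
    U = sum (λ u → sum (L u))

2*σₜ : ∀ {n} (f : Fin n → ℕ) → 2 * σₜ f ≡ sum (λ u → sum (λ v → ∣ f u - f v ∣²))
2*σₜ {n} f = trans (cong (2 *_) (sumFin²≡sum² (upperTriangle sq)))
                   (2*sum-upperTriangle sq-sym (λ u → cong (λ x → x * x) (∣n-n∣≡0 (f u))))
  where
  sq : Fin n → Fin n → ℕ
  sq u v = ∣ f u - f v ∣²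
  sq-sym : ∀ u v → sq u v ≡ sq v u
  sq-sym u v = cong (λ x → x * x) (∣-∣-comm (f u) (f v))

n∸1≤∣n-1∣² : ∀ n → n ∸ 1 ≤ ∣ n - 1 ∣²
n∸1≤∣n-1∣² zero          = z≤n
n∸1≤∣n-1∣² (suc zero)    = z≤n
n∸1≤∣n-1∣² (suc (suc n)) = m≤m*n (suc n) (suc n)

n∸1<∣n-1∣² : ∀ n → 3 ≤ n → n ∸ 1 < ∣ n - 1 ∣²
n∸1<∣n-1∣² (suc zero)          (s≤s ())
n∸1<∣n-1∣² (suc (suc zero))    (s≤s (s≤s ()))
n∸1<∣n-1∣² (suc (suc (suc n))) _ = m<m*n (suc (suc n)) (suc (suc n)) (s≤s (s≤s z≤n))

module TwoLeaves {m} (f : Fin (2 + m) → ℕ) {a b} (a≢b : a ≢ b) (fa≡1 : f a ≡ 1) (fb≡1 : f b ≡ 1) where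

  Inner : Fin (2 + m) → Set
  Inner u = u ≢ a × u ≢ b

  ends : Fin (2 + m) → ℕ
  ends u = δ a u + δ b u

  excess : Fin (2 + m) → ℕ
  excess u = ∣ f u - 1 ∣²

  sum-ends : sum ends ≡ 2
  sum-ends = trans (∑-distrib-+ (δ a) (δ b)) (cong₂ _+_ (sum-δ a) (sum-δ b))

  ends-cases : ∀ u → (ends u ≡ 1 × f u ≡ 1) ⊎ (ends u ≡ 0 × Inner u)
  ends-cases u with a ≟ u | b ≟ u
  ... | yes refl | yes refl = contradiction refl a≢b
  ... | yes refl | no _     = inj₁ (refl , fa≡1)
  ... | no _     | yes refl = inj₁ (refl , fb≡1)
  ... | no a≢u   | no b≢u   = inj₂ (refl , a≢u ∘ sym , b≢u ∘ sym)

  -- The part of ∣ f u - f v ∣² seen from the leaves: when v ∈ {a, b} it is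
  -- excess u, and symmetrically.
  leafPairs : Fin (2 + m) → Fin (2 + m) → ℕ
  leafPairs u v = ends v * excess u + ends u * excess v

  leafPairs-cases : ∀ u v → leafPairs u v ≡ ∣ f u - f v ∣² ⊎ (leafPairs u v ≡ 0 × Inner u × Inner v)
  leafPairs-cases u v with ends-cases u | ends-cases v
  ... | inj₁ (eu , fu) | inj₁ (ev , fv) rewrite eu | ev | fu | fv = inj₁ refl
  ... | inj₁ (eu , fu) | inj₂ (ev , _)  rewrite eu | ev | fu =
    inj₁ (trans (+-identityʳ _) (cong (λ x → x * x) (∣-∣-comm (f v) 1)))
  ... | inj₂ (eu , _)  | inj₁ (ev , fv) rewrite eu | ev | fv = inj₁ (trans (+-identityʳ _) (+-identityʳ _))
  ... | inj₂ (eu , iu) | inj₂ (ev , iv) rewrite eu | ev = inj₂ (refl , iu , iv)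

  sum-leafPairs : sum (λ u → sum (leafPairs u)) ≡ 4 * sum excess
  sum-leafPairs = begin
    sum (λ u → sum (leafPairs u))
      ≡⟨ sum-cong-≗ row ⟩
    sum (λ u → 2 * excess u + ends u * E)
      ≡⟨ ∑-distrib-+ (λ u → 2 * excess u) (λ u → ends u * E) ⟩
    sum (λ u → 2 * excess u) + sum (λ u → ends u * E)
      ≡⟨ cong₂ _+_ (*-distribˡ-sum 2 excess) (*-distribʳ-sum E ends) ⟨
    2 * E + sum ends * E
      ≡⟨ cong (λ k → 2 * E + k * E) sum-ends ⟩
    2 * E + 2 * E
      ≡⟨ *-distribʳ-+ E 2 2 ⟨
    4 * E
      ∎
    where
    open ≡-Reasoning
    E = sum excess
    row : ∀ u → sum (leafPairs u) ≡ 2 * excess u + ends u * E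
    row u = begin
      sum (leafPairs u)
        ≡⟨ ∑-distrib-+ (λ v → ends v * excess u) (λ v → ends u * excess v) ⟩
      sum (λ v → ends v * excess u) + sum (λ v → ends u * excess v)
        ≡⟨ cong₂ _+_ (*-distribʳ-sum (excess u) ends) (*-distribˡ-sum (ends u) excess) ⟨
      sum ends * excess u + ends u * E
        ≡⟨ cong (λ k → k * excess u + ends u * E) sum-ends ⟩
      2 * excess u + ends u * E
        ∎

  2*sum-excess≤σₜ : 2 * sum excess ≤ σₜ f
  2*sum-excess≤σₜ = *-cancelˡ-≤ 2 (begin
    2 * (2 * sum excess)                    ≡⟨ *-assoc 2 2 (sum excess) ⟨
    4 * sum excess                          ≡⟨ sum-leafPairs ⟨
    sum (λ u → sum (leafPairs u))           ≤⟨ sum-mono-≤ (λ u → sum-mono-≤ (leafPairs≤ u)) ⟩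
    sum (λ u → sum (λ v → ∣ f u - f v ∣²))  ≡⟨ 2*σₜ f ⟨
    2 * σₜ f                                ∎)
    where
    open ≤-Reasoning
    leafPairs≤ : ∀ u v → leafPairs u v ≤ ∣ f u - f v ∣²
    leafPairs≤ u v = [ ≤-reflexive , (λ (e , _) → ≤-trans (≤-reflexive e) z≤n) ]′ (leafPairs-cases u v)

  module _ (f≥1 : ∀ u → 1 ≤ f u) (2[1+m]≤sum : 2 * suc m ≤ sum f) where

    m≤sum[f∸1] : m ≤ sum (λ u → f u ∸ 1)
    m≤sum[f∸1] = +-cancelʳ-≤ (2 + m) m _ (begin
      m + (2 + m)                                  ≡⟨ +-suc m (suc m) ⟩
      suc m + suc m                                ≡⟨ cong (suc m +_) (+-identityʳ (suc m)) ⟨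
      2 * suc m                                    ≤⟨ 2[1+m]≤sum ⟩
      sum f                                        ≡⟨ sum-cong-≗ (λ u → m∸n+n≡m (f≥1 u)) ⟨
      sum (λ u → f u ∸ 1 + 1)                      ≡⟨ ∑-distrib-+ (λ u → f u ∸ 1) (λ _ → 1) ⟩
      sum (λ u → f u ∸ 1) + sum {2 + m} (λ _ → 1)  ≡⟨ cong (sum (λ u → f u ∸ 1) +_) (sum-one (2 + m)) ⟩
      sum (λ u → f u ∸ 1) + (2 + m)                ∎)
      where open ≤-Reasoning

    σₜ-lower : 2 * m ≤ σₜ f
    σₜ-lower = begin
      2 * m                    ≤⟨ *-monoʳ-≤ 2 m≤sum[f∸1] ⟩
      2 * sum (λ u → f u ∸ 1)  ≤⟨ *-monoʳ-≤ 2 (sum-mono-≤ (λ u → n∸1≤∣n-1∣² (f u))) ⟩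
      2 * sum excess           ≤⟨ 2*sum-excess≤σₜ ⟩
      σₜ f                     ∎
      where open ≤-Reasoning

    σₜ-strict : ∀ c → 3 ≤ f c → 2 * m < σₜ f
    σₜ-strict c 3≤fc = begin-strict
      2 * m                    ≤⟨ *-monoʳ-≤ 2 m≤sum[f∸1] ⟩
      2 * sum (λ u → f u ∸ 1)  <⟨ *-monoʳ-< 2 (sum-mono-< (n∸1≤∣n-1∣² ∘ f) c (n∸1<∣n-1∣² (f c) 3≤fc)) ⟩
      2 * sum excess           ≤⟨ 2*sum-excess≤σₜ ⟩
      σₜ f                     ∎
      where open ≤-Reasoning

    σₜ≡2m⇒≤2 : σₜ f ≡ 2 * m → ∀ u → f u ≤ 2
    σₜ≡2m⇒≤2 σ≡2m u = ≮⇒≥ λ 2<fu → >⇒≢ (σₜ-strict u 2<fu) σ≡2m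

  module _ (inner≡2 : ∀ u → Inner u → f u ≡ 2) where

    sum-excess≡m : sum excess ≡ m
    sum-excess≡m = +-cancelˡ-≡ 2 _ _ (begin
      2 + sum excess                 ≡⟨ +-comm 2 (sum excess) ⟩
      sum excess + 2                 ≡⟨ cong (sum excess +_) sum-ends ⟨
      sum excess + sum ends          ≡⟨ ∑-distrib-+ excess ends ⟨
      sum (λ u → excess u + ends u)  ≡⟨ sum-cong-≗ excess+ends ⟩
      sum {2 + m} (λ _ → 1)          ≡⟨ sum-one (2 + m) ⟩
      2 + m                          ∎)
      where
      open ≡-Reasoning
      excess+ends : ∀ u → excess u + ends u ≡ 1
      excess+ends u with ends-cases u
      ... | inj₁ (eu , fu) rewrite eu | fu = refl
      ... | inj₂ (eu , iu) rewrite eu | inner≡2 u iu = refl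

    σₜ-exact : σₜ f ≡ 2 * m
    σₜ-exact = *-cancelˡ-≡ (σₜ f) (2 * m) 2 (begin
      2 * σₜ f                                ≡⟨ 2*σₜ f ⟩
      sum (λ u → sum (λ v → ∣ f u - f v ∣²))  ≡⟨ sum-cong-≗ (λ u → sum-cong-≗ (leafPairs≡ u)) ⟨
      sum (λ u → sum (leafPairs u))           ≡⟨ sum-leafPairs ⟩
      4 * sum excess                          ≡⟨ cong (4 *_) sum-excess≡m ⟩
      4 * m                                   ≡⟨ *-assoc 2 2 m ⟩
      2 * (2 * m)                             ∎)
      where
      open ≡-Reasoning
      leafPairs≡ : ∀ u v → leafPairs u v ≡ ∣ f u - f v ∣²
      leafPairs≡ u v with leafPairs-cases u v
      ... | inj₁ e            = e
      ... | inj₂ (e , iu , iv) = trans e (sym (cong₂ ∣_-_∣² (inner≡2 u iu) (inner≡2 v iv)))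

degree≡sum : ∀ {n} (G : Graph n) v → degree G v ≡ sum (λ w → bool→ℕ (adj G v w))
degree≡sum G v = sumFin≡sum (λ w → bool→ℕ (adj G v w))

module _ {n} (G : Graph n) where

  1≤degree : ∀ {v u} → adj G v u ≡ true → 1 ≤ degree G v
  1≤degree {v} {u} vu = begin
    1                               ≡⟨ cong bool→ℕ vu ⟨
    bool→ℕ (adj G v u)              ≤⟨ ≤-sum _ u ⟩
    sum (λ w → bool→ℕ (adj G v w))  ≡⟨ degree≡sum G v ⟨
    degree G v                      ∎
    where open ≤-Reasoning

  2≤degree : ∀ {v u w} → u ≢ w → adj G v u ≡ true → adj G v w ≡ true → 2 ≤ degree G v
  2≤degree {v} {u} {w} u≢w vu vw = begin
    2                                        ≡⟨ cong₂ _+_ (cong bool→ℕ vu) (cong bool→ℕ vw) ⟨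
    bool→ℕ (adj G v u) + bool→ℕ (adj G v w)  ≤⟨ pair-≤-sum _ u≢w ⟩
    sum (λ x → bool→ℕ (adj G v x))           ≡⟨ degree≡sum G v ⟨
    degree G v                               ∎
    where open ≤-Reasoning

  3≤degree : ∀ {v u w x} → u ≢ w → u ≢ x → w ≢ x →
             adj G v u ≡ true → adj G v w ≡ true → adj G v x ≡ true → 3 ≤ degree G v
  3≤degree {v} {u} {w} {x} u≢w u≢x w≢x vu vw vx = begin
    3
      ≡⟨ cong₂ _+_ (cong₂ _+_ (cong bool→ℕ vu) (cong bool→ℕ vw)) (cong bool→ℕ vx) ⟨
    bool→ℕ (adj G v u) + bool→ℕ (adj G v w) + bool→ℕ (adj G v x)
      ≤⟨ triple-≤-sum _ u≢w u≢x w≢x ⟩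
    sum (λ y → bool→ℕ (adj G v y))
      ≡⟨ degree≡sum G v ⟨
    degree G v
      ∎
    where open ≤-Reasoning

  degree≡1 : ∀ {v u} → adj G v u ≡ true → (∀ w → adj G v w ≡ true → w ≡ u) → degree G v ≡ 1
  degree≡1 {v} {u} vu only-u = trans (degree≡sum G v) (trans (sum-single _ u off-u) (cong bool→ℕ vu))
    where
    off-u : ∀ w → w ≢ u → bool→ℕ (adj G v w) ≡ 0
    off-u w w≢u with adj G v w in vw
    ... | true  = contradiction (only-u w vw) w≢u
    ... | false = refl

  walk⇒neighbour : ∀ {v u} → Walk G v u → v ≢ u → ∃ λ w → adj G v w ≡ true
  walk⇒neighbour here        v≢v = contradiction refl v≢v
  walk⇒neighbour (step vw _) _   = _ , vw

  walk-exits : ∀ {p} {Q : Fin n → Set p} → Decidable Q → ∀ {v w} → Walk G v w → Q v → ¬ Q w →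
               ∃ λ x → ∃ λ y → Q x × ¬ Q y × adj G x y ≡ true
  walk-exits Q? here                   qv ¬qw = contradiction qv ¬qw
  walk-exits Q? (step {w = u} vu walk) qv ¬qw with Q? u
  ... | yes qu = walk-exits Q? walk qu ¬qw
  ... | no ¬qu = _ , u , qv , ¬qu , vu

connected⇒neighbour : ∀ {m} {G : Graph (2 + m)} → Connected G → ∀ v → ∃ λ u → adj G v u ≡ true
connected⇒neighbour {G = G} connected zero    = walk⇒neighbour G (connected zero (suc zero)) λ ()
connected⇒neighbour {G = G} connected (suc v) = walk⇒neighbour G (connected (suc v) zero) λ ()

degree-preserved : ∀ {n} {G H : Graph n} ((φ , _) : Isomorphic G H) v → degree H (Inverse.to φ v) ≡ degree G v
degree-preserved {G = G} {H} (φ , adj≡) v = begin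
  degree H (to v)                           ≡⟨ degree≡sum H (to v) ⟩
  sum (λ w → bool→ℕ (adj H (to v) w))       ≡⟨ sum-permute _ φ ⟩
  sum (λ w → bool→ℕ (adj H (to v) (to w)))  ≡⟨ sum-cong-≗ (λ w → cong bool→ℕ (adj≡ v w)) ⟨
  sum (λ w → bool→ℕ (adj G v w))            ≡⟨ degree≡sum G v ⟨
  degree G v                                ∎
  where
  open ≡-Reasoning
  open Inverse φ using (to)

∣m-n∣≡ᵇ1≤ : ∀ m n →
  bool→ℕ (∣ m - n ∣ ≡ᵇ 1) ≤ bool→ℕ (n ≡ᵇ suc m) + bool→ℕ (m ≡ᵇ suc n)
∣m-n∣≡ᵇ1≤ zero          zero          = z≤n
∣m-n∣≡ᵇ1≤ zero          (suc zero)    = ≤-refl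
∣m-n∣≡ᵇ1≤ zero          (suc (suc n)) = z≤n
∣m-n∣≡ᵇ1≤ (suc zero)    zero          = ≤-refl
∣m-n∣≡ᵇ1≤ (suc (suc m)) zero          = z≤n
∣m-n∣≡ᵇ1≤ (suc m)       (suc n)       = ∣m-n∣≡ᵇ1≤ m n

degree-pathGraph≤2 : ∀ {n} (i : Fin n) → degree (pathGraph n) i ≤ 2
degree-pathGraph≤2 {n} i = begin
  degree (pathGraph n) i
    ≡⟨ degree≡sum (pathGraph n) i ⟩
  sum (λ (j : Fin n) → bool→ℕ (∣ x - toℕ j ∣ ≡ᵇ 1))
    ≤⟨ sum-mono-≤ (λ (j : Fin n) → ∣m-n∣≡ᵇ1≤ x (toℕ j)) ⟩
  sum (λ j → bool→ℕ (successor j) + bool→ℕ (predecessor j))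
    ≡⟨ ∑-distrib-+ (bool→ℕ ∘ successor) (bool→ℕ ∘ predecessor) ⟩
  sum (bool→ℕ ∘ successor) + sum (bool→ℕ ∘ predecessor)
    ≤⟨ +-mono-≤ (sum-≤-1 successor successor-unique) (sum-≤-1 predecessor predecessor-unique) ⟩
  2
    ∎
  where
  open ≤-Reasoning
  x = toℕ i
  successor predecessor : Fin n → Bool
  successor   j = toℕ j ≡ᵇ suc x
  predecessor j = x ≡ᵇ suc (toℕ j)
  successor-unique : ∀ {j k} → T (successor j) → T (successor k) → j ≡ k
  successor-unique tj tk = toℕ-injective (trans (≡ᵇ⇒≡ _ _ tj) (sym (≡ᵇ⇒≡ _ _ tk)))
  predecessor-unique : ∀ {j k} → T (predecessor j) → T (predecessor k) → j ≡ k
  predecessor-unique tj tk = toℕ-injective (suc-injective (trans (sym (≡ᵇ⇒≡ x _ tj)) (≡ᵇ⇒≡ x _ tk)))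

isomorphic-pathGraph⇒degree≤2 : ∀ {n} {G : Graph n} → Isomorphic G (pathGraph n) → ∀ v → degree G v ≤ 2
isomorphic-pathGraph⇒degree≤2 {G = G} iso v =
  ≤-trans (≤-reflexive (sym (degree-preserved {G = G} {pathGraph _} iso v)))
          (degree-pathGraph≤2 (Inverse.to (proj₁ iso) v))

-- Breadth-first spanning trees

-- A spanning tree of G rooted at zero.
record ParentMap {k} (G : Graph (suc k)) : Set where
  field
    parent          : Fin k → Fin (suc k)
    rank            : Fin (suc k) → ℕ
    parent-adjacent : ∀ j → adj G (suc j) (parent j) ≡ true
    rank-parent<    : ∀ j → rank (parent j) < rank (suc j)

+-≤-disjoint : ∀ {x y z} → x ≤ z → y ≤ z → (0 < x → 0 < y → ⊥) → x + y ≤ z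
+-≤-disjoint {zero}          x≤z y≤z _        = y≤z
+-≤-disjoint {suc x} {zero}  x≤z y≤z _        = ≤-trans (≤-reflexive (+-identityʳ (suc x))) x≤z
+-≤-disjoint {suc _} {suc _} x≤z y≤z disjoint = contradiction (s≤s z≤n) (disjoint (s≤s z≤n))

module _ {k} {G : Graph (suc k)} (P : ParentMap G) where
  open ParentMap P

  treeEdge : Fin (suc k) → Fin (suc k) → ℕ
  treeEdge zero    w = 0
  treeEdge (suc j) w = δ (parent j) w

  treeEdge⇒parent : ∀ j w → 0 < treeEdge (suc j) w → parent j ≡ w
  treeEdge⇒parent j w pos with parent j ≟ w
  ... | yes p≡w = p≡w
  ... | no _    = contradiction pos λ ()

  treeEdge≤adj : ∀ u w → treeEdge u w ≤ bool→ℕ (adj G u w)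
  treeEdge≤adj zero    w = z≤n
  treeEdge≤adj (suc j) w with parent j ≟ w
  ... | yes refl = ≤-reflexive (cong bool→ℕ (sym (parent-adjacent j)))
  ... | no _     = z≤n

  treeEdge-asym : ∀ u w → 0 < treeEdge u w → 0 < treeEdge w u → ⊥
  treeEdge-asym (suc i) (suc j) uw wu =
    <-asym (subst (λ x → rank x < rank (suc i)) (treeEdge⇒parent i (suc j) uw) (rank-parent< i))
           (subst (λ x → rank x < rank (suc j)) (treeEdge⇒parent j (suc i) wu) (rank-parent< j))

  sum-treeEdge : sum (λ u → sum (treeEdge u)) ≡ k
  sum-treeEdge = cong₂ _+_ (sum-zero {suc k} λ _ → refl)
                           (trans (sum-cong-≗ (sum-δ ∘ parent)) (sum-one k))

  parentMap⇒2k≤sum-degree : 2 * k ≤ sum (degree G)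
  parentMap⇒2k≤sum-degree = begin
    2 * k
      ≡⟨ cong (k +_) (+-identityʳ k) ⟩
    k + k
      ≡⟨ cong₂ _+_ sum-treeEdge (trans (sym (∑-comm treeEdge)) sum-treeEdge) ⟨
    sum (λ u → sum (treeEdge u)) + sum (λ u → sum (λ w → treeEdge w u))
      ≡⟨ ∑-distrib-+ (λ u → sum (treeEdge u)) (λ u → sum (λ w → treeEdge w u)) ⟨
    sum (λ u → sum (treeEdge u) + sum (λ w → treeEdge w u))
      ≡⟨ sum-cong-≗ (λ u → ∑-distrib-+ (treeEdge u) (λ w → treeEdge w u)) ⟨
    sum (λ u → sum (λ w → treeEdge u w + treeEdge w u))
      ≤⟨ sum-mono-≤ (λ u → sum-mono-≤ (both≤adj u)) ⟩
    sum (λ u → sum (λ w → bool→ℕ (adj G u w)))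
      ≡⟨ sum-cong-≗ (degree≡sum G) ⟨
    sum (degree G)
      ∎
    where
    open ≤-Reasoning
    both≤adj : ∀ u w → treeEdge u w + treeEdge w u ≤ bool→ℕ (adj G u w)
    both≤adj u w = +-≤-disjoint (treeEdge≤adj u w)
                                (subst (λ b → treeEdge w u ≤ bool→ℕ b) (symm G w u) (treeEdge≤adj w u))
                                (treeEdge-asym u w)

least : ∀ {p} {P : ℕ → Set p} → Decidable P → ∀ {n} → P n → ∃ λ m → P m × (∀ {k} → P k → m ≤ k)
least P? {zero}  pn = 0 , pn , λ _ → z≤n
least P? {suc n} pn with P? 0
... | yes p₀ = 0 , p₀ , λ _ → z≤n
... | no ¬p₀ with least (P? ∘ suc) pn
...   | m , pm , minimal = suc m , pm , λ { {zero} p₀ → contradiction p₀ ¬p₀ ; {suc k} pk → s≤s (minimal pk) }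

module _ {k} {G : Graph (suc k)} (connected : Connected G) where

  Near : ℕ → Fin (suc k) → Set
  Near zero    v = v ≡ zero
  Near (suc r) v = Near r v ⊎ ∃ λ u → adj G v u ≡ true × Near r u

  near? : ∀ r v → Dec (Near r v)
  near? zero    v = v ≟ zero
  near? (suc r) v = near? r v ⊎-dec any? (λ u → (adj G v u Bool.≟ true) ×-dec near? r u)

  walk⇒near : ∀ {v} → Walk G v zero → ∃ λ r → Near r v
  walk⇒near here        = 0 , refl
  walk⇒near (step vu w) = let r , near = walk⇒near w in suc r , inj₂ (_ , vu , near)

  nearest : ∀ v → ∃ λ r → Near r v × (∀ {s} → Near s v → r ≤ s)
  nearest v = least (λ r → near? r v) (proj₂ (walk⇒near (connected v zero)))

  distance : Fin (suc k) → ℕ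
  distance v = proj₁ (nearest v)

  closerNeighbour : ∀ j → ∃ λ u → adj G (suc j) u ≡ true × distance u < distance (suc j)
  closerNeighbour j with nearest (suc j)
  ... | suc r , inj₁ near , minimal  = contradiction (minimal near) (n≮n r)
  ... | suc r , inj₂ (u , vu , near) , _ = u , vu , s≤s (proj₂ (proj₂ (nearest u)) near)

  connected⇒parentMap : ParentMap G
  connected⇒parentMap = record
    { parent          = proj₁ ∘ closerNeighbour
    ; rank            = distance
    ; parent-adjacent = proj₁ ∘ proj₂ ∘ closerNeighbour
    ; rank-parent<    = proj₂ ∘ proj₂ ∘ closerNeighbour
    }

-- Paths

module _ {n} (G : Graph n) where

  -- Only the values vertex 0, …, vertex len are part of the path.
  record Path : Set where
    field
      len              : ℕ
      vertex           : ℕ → Fin n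
      vertex-injective : ∀ {i j} → i ≤ len → j ≤ len → vertex i ≡ vertex j → i ≡ j
      vertex-adjacent  : ∀ {i} → i < len → adj G (vertex i) (vertex (suc i)) ≡ true

  open Path public

  OnPath : Path → Fin n → Set
  OnPath P y = ∃ λ i → i ≤ len P × vertex P i ≡ y

  onPath? : ∀ P y → Dec (OnPath P y)
  onPath? P y = map′ (λ (i , i<1+l , e) → i , ≤-pred i<1+l , e) (λ (i , i≤l , e) → i , s≤s i≤l , e)
                     (anyUpTo? (λ i → vertex P i ≟ y) (suc (len P)))

  NeighboursOnPath : Path → Fin n → Set
  NeighboursOnPath P v = ∀ y → adj G v y ≡ true → OnPath P y

  Maximal : Path → Set
  Maximal P = NeighboursOnPath P (vertex P 0) × NeighboursOnPath P (vertex P (len P))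

  1+len≤n : ∀ P → suc (len P) ≤ n
  1+len≤n P = injective⇒≤ {f = vertex P ∘ toℕ}
    (λ {s} {t} e → toℕ-injective (vertex-injective P (toℕ≤pred[n] s) (toℕ≤pred[n] t) e))

  singleton : Fin n → Path
  singleton v = record
    { len              = 0
    ; vertex           = λ _ → v
    ; vertex-injective = λ { z≤n z≤n _ → refl }
    ; vertex-adjacent  = λ ()
    }

  prepend : ∀ y P → adj G y (vertex P 0) ≡ true → ¬ OnPath P y → Path
  prepend y P y~P y∉P = record
    { len              = suc (len P)
    ; vertex           = vertex′
    ; vertex-injective = injective
    ; vertex-adjacent  = adjacent
    }
    where
    vertex′ : ℕ → Fin n
    vertex′ zero    = y
    vertex′ (suc i) = vertex P i
    injective : ∀ {i j} → i ≤ suc (len P) → j ≤ suc (len P) → vertex′ i ≡ vertex′ j → i ≡ j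
    injective {zero}  {zero}  _         _         _ = refl
    injective {zero}  {suc j} _         (s≤s j≤l) e = contradiction (j , j≤l , sym e) y∉P
    injective {suc i} {zero}  (s≤s i≤l) _         e = contradiction (i , i≤l , e) y∉P
    injective {suc i} {suc j} (s≤s i≤l) (s≤s j≤l) e = cong suc (vertex-injective P i≤l j≤l e)
    adjacent : ∀ {i} → i < suc (len P) → adj G (vertex′ i) (vertex′ (suc i)) ≡ true
    adjacent {zero}  _         = y~P
    adjacent {suc i} (s≤s i<l) = vertex-adjacent P i<l

  prepend-onPath : ∀ {y P y~P y∉P z} → OnPath P z → OnPath (prepend y P y~P y∉P) z
  prepend-onPath (i , i≤l , e) = suc i , s≤s i≤l , e

  reverse : Path → Path
  reverse P = record
    { len              = len P
    ; vertex           = λ i → vertex P (len P ∸ i)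
    ; vertex-injective = λ {i} {j} i≤l j≤l e →
                           ∸-cancelˡ-≡ i≤l j≤l (vertex-injective P (m∸n≤m (len P) i) (m∸n≤m (len P) j) e)
    ; vertex-adjacent  = adjacent
    }
    where
    adjacent : ∀ {i} → i < len P → adj G (vertex P (len P ∸ i)) (vertex P (len P ∸ suc i)) ≡ true
    adjacent {i} i<l rewrite +-∸-assoc 1 i<l =
      trans (symm G _ _) (vertex-adjacent P (subst (_≤ len P) (+-∸-assoc 1 i<l) (m∸n≤m (len P) i)))

  reverse-onPath : ∀ {P y} → OnPath P y → OnPath (reverse P) y
  reverse-onPath {P} (i , i≤l , e) = len P ∸ i , m∸n≤m _ i , trans (cong (vertex P) (m∸[m∸n]≡n i≤l)) e

  reverse-front : ∀ {P} → NeighboursOnPath P (vertex P (len P)) →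
                  NeighboursOnPath (reverse P) (vertex (reverse P) 0)
  reverse-front {P} back y a = reverse-onPath {P} (back y a)

  reverse-back : ∀ {P} → NeighboursOnPath P (vertex P 0) →
                 NeighboursOnPath (reverse P) (vertex (reverse P) (len P))
  reverse-back {P} front y a =
    reverse-onPath {P} (front y (subst (λ i → adj G (vertex P i) y ≡ true) (n∸n≡0 (len P)) a))

  extendFront : ∀ fuel P → n ≤ len P + fuel →
    Σ Path λ P′ → NeighboursOnPath P′ (vertex P′ 0)
                × (NeighboursOnPath P (vertex P (len P)) → NeighboursOnPath P′ (vertex P′ (len P′)))
  extendFront fuel P n≤l+fuel with any? (λ y → (adj G (vertex P 0) y Bool.≟ true) ×-dec ¬? (onPath? P y))
  ... | no none =
    P , (λ y a → decidable-stable (onPath? P y) (λ y∉P → none (y , a , y∉P))) , λ back → back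
  extendFront zero P n≤l+0 | yes _ =
    contradiction (subst (n ≤_) (+-identityʳ _) n≤l+0) (<⇒≱ (1+len≤n P))
  extendFront (suc fuel) P n≤l+fuel | yes (y , a , y∉P) =
    let P′ , front , keepBack = extendFront fuel (prepend y P y~P y∉P) (subst (n ≤_) (+-suc (len P) fuel) n≤l+fuel)
    in  P′ , front , λ back → keepBack (λ z b → prepend-onPath {y} {P} {y~P} {y∉P} (back z b))
    where y~P = trans (symm G y (vertex P 0)) a

  -- Extend at the front, reverse, and extend at the new front; extending at
  -- the front keeps the back closed.
  maximalPath : Fin n → Σ Path Maximal
  maximalPath v with extendFront n (singleton v) ≤-refl
  ... | P₁ , front₁ , _ with extendFront n (reverse P₁) (m≤n+m n (len P₁))
  ... | P₂ , front₂ , keepBack = P₂ , front₂ , keepBack (reverse-back {P₁} front₁)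

∣m-n∣≡ᵇ1⇒consecutive : ∀ m n → (∣ m - n ∣ ≡ᵇ 1) ≡ true → n ≡ suc m ⊎ m ≡ suc n
∣m-n∣≡ᵇ1⇒consecutive zero       (suc zero) _ = inj₁ refl
∣m-n∣≡ᵇ1⇒consecutive (suc zero) zero       _ = inj₂ refl
∣m-n∣≡ᵇ1⇒consecutive (suc m)    (suc n)    e =
  Sum.map (cong suc) (cong suc) (∣m-n∣≡ᵇ1⇒consecutive m n e)

consecutive⇒∣m-n∣≡ᵇ1 : ∀ {m n} → n ≡ suc m ⊎ m ≡ suc n → (∣ m - n ∣ ≡ᵇ 1) ≡ true
consecutive⇒∣m-n∣≡ᵇ1 {zero}      (inj₁ refl) = refl
consecutive⇒∣m-n∣≡ᵇ1 {suc m}     (inj₁ refl) = consecutive⇒∣m-n∣≡ᵇ1 {m} (inj₁ refl)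
consecutive⇒∣m-n∣≡ᵇ1 {n = zero}  (inj₂ refl) = refl
consecutive⇒∣m-n∣≡ᵇ1 {n = suc n} (inj₂ refl) = consecutive⇒∣m-n∣≡ᵇ1 {n = n} (inj₂ refl)

module _ {n} {G : Graph n} where

  irreflexive : ∀ {v} → adj G v v ≡ true → ⊥
  irreflexive {v} vv = contradiction (trans (sym vv) (irrefl G v)) λ ()

  chord⇒cycle : ∀ (P : Path G) {i m} → i + suc (suc m) ≤ len P →
                adj G (vertex P i) (vertex P (i + suc (suc m))) ≡ true → Cycle G
  chord⇒cycle P {i} {m} i+2+m≤l chord = record
    { m      = m
    ; c      = c
    ; inj    = λ {s} {t} e → toℕ-injective (+-cancelˡ-≡ i _ _ (vertex-injective P (bound s) (bound t) e))
    ; consec = consec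
    ; close  = close
    }
    where
    c : Fin (3 + m) → Fin n
    c t = vertex P (i + toℕ t)
    bound : ∀ t → i + toℕ t ≤ len P
    bound t = ≤-trans (+-monoʳ-≤ i (toℕ≤pred[n] t)) i+2+m≤l
    consec : ∀ t → adj G (c (inject₁ t)) (c (suc t)) ≡ true
    consec t rewrite toℕ-inject₁ t | +-suc i (toℕ t) =
      vertex-adjacent P {i + toℕ t} (≤-trans (≤-reflexive (sym (+-suc i (toℕ t)))) (bound (suc t)))
    close : adj G (c (fromℕ (2 + m))) (c zero) ≡ true
    close rewrite toℕ-fromℕ (2 + m) | +-identityʳ i = trans (symm G _ _) chord

  module _ (acyclic : Acyclic G) (P : Path G) where

    chordless< : ∀ {i j} → i < j → j ≤ len P → adj G (vertex P i) (vertex P j) ≡ true → j ≡ suc i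
    chordless< {i} i<j j≤l a with m≤n⇒∃[o]m+o≡n i<j
    ... | zero  , refl = cong suc (+-identityʳ i)
    ... | suc m , refl = contradiction (chord⇒cycle P {i} {m} (subst (_≤ len P) ≡i+2+m j≤l) chord) acyclic
      where
      ≡i+2+m = sym (+-suc i (suc m))
      chord = subst (λ j → adj G (vertex P i) (vertex P j) ≡ true) ≡i+2+m a

    chordless : ∀ {i j} → i ≤ len P → j ≤ len P → adj G (vertex P i) (vertex P j) ≡ true →
                j ≡ suc i ⊎ i ≡ suc j
    chordless {i} {j} i≤l j≤l a with <-cmp i j
    ... | tri< i<j _ _ = inj₁ (chordless< i<j j≤l a)
    ... | tri≈ _ refl _ = contradiction a irreflexive
    ... | tri> _ _ j<i = inj₂ (chordless< j<i i≤l (trans (symm G _ _) a))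

    adj-on-path : ∀ {i j} → i ≤ len P → j ≤ len P → adj G (vertex P i) (vertex P j) ≡ (∣ i - j ∣ ≡ᵇ 1)
    adj-on-path {i} {j} i≤l j≤l = ⇔→≡ (mk⇔ (consecutive⇒∣m-n∣≡ᵇ1 ∘ chordless i≤l j≤l)
                                          (consecutive⇒adjacent ∘ ∣m-n∣≡ᵇ1⇒consecutive i j))
      where
      consecutive⇒adjacent : j ≡ suc i ⊎ i ≡ suc j → adj G (vertex P i) (vertex P j) ≡ true
      consecutive⇒adjacent (inj₁ refl) = vertex-adjacent P j≤l
      consecutive⇒adjacent (inj₂ refl) = trans (symm G _ _) (vertex-adjacent P i≤l)

    module _ (front-closed : NeighboursOnPath G P (vertex P 0)) where

      front-neighbour : ∀ {y} → adj G (vertex P 0) y ≡ true → 1 ≤ len P × y ≡ vertex P 1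
      front-neighbour {y} a with front-closed y a
      ... | i , i≤l , refl with chordless z≤n i≤l a
      ... | inj₁ refl = i≤l , refl

      front-leaf : ∀ {y} → adj G (vertex P 0) y ≡ true → 1 ≤ len P × degree G (vertex P 0) ≡ 1
      front-leaf a = 1≤l , degree≡1 G (vertex-adjacent P 1≤l) (λ w aw → proj₂ (front-neighbour aw))
        where 1≤l = proj₁ (front-neighbour a)

-- Maximal paths in trees

module MaximalPath {m} {G : Graph (2 + m)} (connected : Connected G) (acyclic : Acyclic G)
                   (P : Path G) (maximal : Maximal G P) where

  front back : Fin (2 + m)
  front = vertex P 0
  back  = vertex P (len P)

  1≤len×front-degree≡1 : 1 ≤ len P × degree G front ≡ 1
  1≤len×front-degree≡1 = front-leaf acyclic P (proj₁ maximal) (proj₂ (connected⇒neighbour connected front))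

  1≤len : 1 ≤ len P
  1≤len = proj₁ 1≤len×front-degree≡1

  front-degree≡1 : degree G front ≡ 1
  front-degree≡1 = proj₂ 1≤len×front-degree≡1

  back-degree≡1 : degree G back ≡ 1
  back-degree≡1 = proj₂ (front-leaf acyclic (reverse G P) (reverse-front G {P} (proj₂ maximal))
                                    (proj₂ (connected⇒neighbour connected back)))

  front≢back : front ≢ back
  front≢back e = <⇒≢ 1≤len (vertex-injective P z≤n ≤-refl e)

  interior-neighbours : ∀ {i} → suc i < len P →
    adj G (vertex P (suc i)) (vertex P i) ≡ true × adj G (vertex P (suc i)) (vertex P (2 + i)) ≡ true ×
    vertex P i ≢ vertex P (2 + i)
  interior-neighbours {i} 2+i≤l =
      trans (symm G _ _) (vertex-adjacent P (≤-trans (n≤1+n (suc i)) 2+i≤l))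
    , vertex-adjacent P 2+i≤l
    , λ e → <⇒≢ (m<n⇒m<1+n (n<1+n i)) (vertex-injective P (≤-trans (m≤n+m i 2) 2+i≤l) 2+i≤l e)

  interior-2≤degree : ∀ {i} → suc i < len P → 2 ≤ degree G (vertex P (suc i))
  interior-2≤degree 2+i≤l = let ai , a2i , ne = interior-neighbours 2+i≤l in 2≤degree G ne ai a2i

  interior-3≤degree : ∀ {i y} → suc i < len P → ¬ OnPath G P y → adj G (vertex P (suc i)) y ≡ true →
                      3 ≤ degree G (vertex P (suc i))
  interior-3≤degree {i} 2+i≤l y∉P a =
    let ai , a2i , ne = interior-neighbours 2+i≤l
    in  3≤degree G ne (λ e → y∉P (i , ≤-trans (m≤n+m i 2) 2+i≤l , e)) (λ e → y∉P (2 + i , 2+i≤l , e))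
                   ai a2i a

  module _ (degree≤2 : ∀ v → degree G v ≤ 2) where

    -- A walk from the front to a vertex off the path would have to leave the
    -- path at an interior vertex, giving it a third neighbour.
    onPath : ∀ w → OnPath G P w
    onPath w with onPath? G P w
    ... | yes w∈P = w∈P
    ... | no w∉P with walk-exits G (onPath? G P) (connected front w) (0 , z≤n , refl) w∉P
    ... | _ , y , (zero , _ , refl) , y∉P , a = contradiction (proj₁ maximal y a) y∉P
    ... | _ , y , (suc i , i<l , refl) , y∉P , a with m≤n⇒m<n∨m≡n i<l
    ...   | inj₂ refl  = contradiction (proj₂ maximal y a) y∉P
    ...   | inj₁ 2+i≤l = contradiction (degree≤2 _) (<⇒≱ (interior-3≤degree 2+i≤l y∉P a))

    inner-degree≡2 : ∀ u → u ≢ front × u ≢ back → degree G u ≡ 2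
    inner-degree≡2 u (u≢front , u≢back) with onPath u
    ... | zero , _ , refl = contradiction refl u≢front
    ... | suc i , i<l , refl with m≤n⇒m<n∨m≡n i<l
    ...   | inj₂ refl  = contradiction refl u≢back
    ...   | inj₁ 2+i≤l = ≤-antisym (degree≤2 _) (interior-2≤degree 2+i≤l)

    index : Fin (2 + m) → ℕ
    index w = proj₁ (onPath w)

    index≤len : ∀ w → index w ≤ len P
    index≤len w = proj₁ (proj₂ (onPath w))

    vertex-index : ∀ w → vertex P (index w) ≡ w
    vertex-index w = proj₂ (proj₂ (onPath w))

    index-injective : ∀ {u w} → index u ≡ index w → u ≡ w
    index-injective {u} {w} e = trans (sym (vertex-index u)) (trans (cong (vertex P) e) (vertex-index w))

    n≤1+len : 2 + m ≤ suc (len P)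
    n≤1+len = injective⇒≤ {f = λ w → fromℕ< (s≤s (index≤len w))}
                          (index-injective ∘ fromℕ<-injective _ _ _ _)

    toIndex : Fin (2 + m) → Fin (2 + m)
    toIndex w = fromℕ< (≤-trans (s≤s (index≤len w)) (1+len≤n G P))

    toℕ-toIndex : ∀ w → toℕ (toIndex w) ≡ index w
    toℕ-toIndex w = toℕ-fromℕ< _

    toVertex : Fin (2 + m) → Fin (2 + m)
    toVertex i = vertex P (toℕ i)

    toIndex-toVertex : ∀ i → toIndex (toVertex i) ≡ i
    toIndex-toVertex i = toℕ-injective (trans (toℕ-toIndex _)
      (vertex-injective P (index≤len _) (≤-pred (≤-trans (toℕ<n i) n≤1+len)) (vertex-index _)))

    toVertex-toIndex : ∀ w → toVertex (toIndex w) ≡ w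
    toVertex-toIndex w = trans (cong (vertex P) (toℕ-toIndex w)) (vertex-index w)

    isomorphic : Isomorphic G (pathGraph (2 + m))
    isomorphic = mk↔ₛ′ toIndex toVertex toIndex-toVertex toVertex-toIndex , λ u w → begin
      adj G u w
        ≡⟨ cong₂ (adj G) (vertex-index u) (vertex-index w) ⟨
      adj G (vertex P (index u)) (vertex P (index w))
        ≡⟨ adj-on-path acyclic P (index≤len u) (index≤len w) ⟩
      ∣ index u - index w ∣ ≡ᵇ 1
        ≡⟨ cong₂ (λ i j → ∣ i - j ∣ ≡ᵇ 1) (toℕ-toIndex u) (toℕ-toIndex w) ⟨
      adj (pathGraph (2 + m)) (toIndex u) (toIndex w)
        ∎
      where open ≡-Reasoning

corollary16 : (n : ℕ) → 2 ≤ n → (T : Graph n) → IsTree T →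
    (2 * n ∸ 4 ≤ sigmaT T) × ((sigmaT T ≡ 2 * n ∸ 4) ⇔ Isomorphic T (pathGraph n))
corollary16 (suc zero)    (s≤s ())
corollary16 (suc (suc m)) _ T (connected , acyclic) =
    subst (_≤ sigmaT T) 2m≡2n∸4 (σₜ-lower degree≥1 degreeSum)
  , mk⇔ (λ σ≡ → isomorphic (σₜ≡2m⇒≤2 degree≥1 degreeSum (trans σ≡ (sym 2m≡2n∸4))))
        (λ T≅P → trans (σₜ-exact (inner-degree≡2 (isomorphic-pathGraph⇒degree≤2 {G = T} T≅P))) 2m≡2n∸4)
  where
  P = proj₁ (maximalPath T zero)
  open MaximalPath connected acyclic P (proj₂ (maximalPath T zero))
  open TwoLeaves (degree T) front≢back front-degree≡1 back-degree≡1

  2m≡2n∸4 : 2 * m ≡ 2 * (2 + m) ∸ 4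
  2m≡2n∸4 = *-distribˡ-∸ 2 (2 + m) 2

  degree≥1 : ∀ v → 1 ≤ degree T v
  degree≥1 v = 1≤degree T (proj₂ (connected⇒neighbour connected v))

  degreeSum : 2 * suc m ≤ sum (degree T)
  degreeSum = parentMap⇒2k≤sum-degree (connected⇒parentMap connected)
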